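{- Let $p$ be any pattern in the symmetry class of one of $(123,\emptyset,\{0\})$, $(123,\{0\},\{2\})$, $(132,\emptyset,\{0\})$, $(132,\{0\},\{2\})$. Then for all $n\ge1$, \[a_n(p)=\sum_{k=0}^{n-1}\frac{(n-1)!}{k!}.\]
   Context: A bi-vincular pattern of length $k$ is a triple $p=(\sigma,X,Y)$ with $\sigma$ a permutation of $[k]$ in one-line notation and $X,Y\subseteq\{0,1,\dots,k\}$. A permutation $\pi=\pi_1\cdots\pi_n$ of $[n]$ contains $p$ if there are indices $1\le i_1<\dots<i_k\le n$ such that $(\pi_{i_1},\dots,\pi_{i_k})$ is order-isomorphic to $\sigma$ and, writing $j_1<\dots<j_k$ for the set $\{\pi_{i_1},\dots,\pi_{i_k}\}$ in increasing order and setting $i_0=j_0=0$, $i_{k+1}=j_{k+1}=n+1$, we have $i_{x+1}=i_x+1$ for all $x\in X$ and $j_{y+1}=j_y+1$ for all $y\in Y$. Otherwise $\pi$ avoids $p$; $a_n(p)$ is the number of permutations of $[n]$ avoiding $p$. For $p=(\sigma,X,Y)$ of length $k$ define $p^{i}=(\sigma^{ -1},Y,X)$, $p^{r}=(\sigma^{r},\{k-x:x\in X\},Y)$, $p^{c}=(\sigma^{c},X,\{k-y:y\in Y\})$, with $\sigma^r_m=\sigma_{k+1-m}$ and $\sigma^c_m=k+1-\sigma_m$; the symmetry class of $p$ is the set of patterns obtained from $p$ by finite compositions of $i,r,c$. -}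

module Defs where

open import Data.Nat as ℕ using (ℕ; zero; suc; _+_; _∸_)
open import Data.Nat.Properties using (_!≢0)
open import Data.Nat using (_!)
open import Data.Nat.DivMod using (_/_)
open import Data.Fin as Fin using (Fin; toℕ; opposite)
open import Data.Fin.Subset using (Subset; _∈_; ⁅_⁆)
open import Data.Vec using (Vec; lookup; reverse; map; _∷_; [])
open import Data.List using (List; length; upTo)
open import Data.Nat.ListAction using (sum)
import Data.List as List
open import Data.List.Membership.Propositional renaming (_∈_ to _∈ₗ_)
open import Data.List.Relation.Unary.Unique.Propositional using (Unique)
open import Data.Product using (Σ; ∃; _×_)
open import Function.Bundles using (_⇔_)
open import Relation.Binary.PropositionalEquality using (_≡_)
open import Relation.Nullary using (¬_)

-- Conventions: permutations of [n] are vectors of length n over Fin n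
-- with pairwise distinct entries; the value i : Fin n stands for i+1,
-- and position p : Fin n stands for position p+1.

IsPerm : ∀ {n} → Vec (Fin n) n → Set
IsPerm {n} π = ∀ (i j : Fin n) → lookup π i ≡ lookup π j → i ≡ j

-- A bi-vincular pattern of length k: (σ , X , Y) with X, Y ⊆ {0,…,k}
-- (subsets of Fin (suc k), element x standing for the number toℕ x).
record Pattern (k : ℕ) : Set where
  constructor pat
  field
    σ : Vec (Fin k) k
    X : Subset (suc k)
    Y : Subset (suc k)
open Pattern public

module _ {k n : ℕ} (p : Pattern k) (π : Vec (Fin n) n) (ι : Fin k → Fin n) where

  -- i_m = v  (1-indexed positions, with i_0 = 0, i_{k+1} = n+1)
  data IIs : ℕ → ℕ → Set where
    i-zero : IIs 0 0
    i-mid  : ∀ (a : Fin k) → IIs (suc (toℕ a)) (suc (toℕ (ι a)))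
    i-top  : IIs (suc k) (suc n)

  -- j_m = v  where j_1 < … < j_k is the sorted set of the values
  -- π_{i_1},…,π_{i_k}  (1-indexed values, j_0 = 0, j_{k+1} = n+1).
  -- Given order-isomorphism with σ, the m-th smallest value is the one
  -- at the occurrence position a with σ_a = m.
  data JIs : ℕ → ℕ → Set where
    j-zero : JIs 0 0
    j-mid  : ∀ (a : Fin k) →
             JIs (suc (toℕ (lookup (σ p) a))) (suc (toℕ (lookup π (ι a))))
    j-top  : JIs (suc k) (suc n)

  Occurrence : Set
  Occurrence =
      (∀ (a b : Fin k) → a Fin.< b → ι a Fin.< ι b)
    × (∀ (a b : Fin k) → (lookup (σ p) a Fin.< lookup (σ p) b → lookup π (ι a) Fin.< lookup π (ι b))
                       × (lookup π (ι a) Fin.< lookup π (ι b) → lookup (σ p) a Fin.< lookup (σ p) b))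
    × (∀ (x : Fin (suc k)) → x ∈ X p → ∀ u v → IIs (toℕ x) u → IIs (suc (toℕ x)) v → v ≡ suc u)
    × (∀ (y : Fin (suc k)) → y ∈ Y p → ∀ u v → JIs (toℕ y) u → JIs (suc (toℕ y)) v → v ≡ suc u)

Contains : ∀ {k n} → Pattern k → Vec (Fin n) n → Set
Contains {k} {n} p π = ∃ λ (ι : Fin k → Fin n) → Occurrence p π ι

Avoids : ∀ {k n} → Pattern k → Vec (Fin n) n → Set
Avoids p π = ¬ Contains p π

-- a_n(p) = N : the permutations of [n] avoiding p are exactly the
-- entries of a duplicate-free list of length N.
AvoidCount : ∀ {k} → Pattern k → ℕ → ℕ → Set
AvoidCount {k} p n N =
  Σ (List (Vec (Fin n) n)) λ L →
      Unique L
    × (∀ (π : Vec (Fin n) n) → (π ∈ₗ L) ⇔ (IsPerm π × Avoids p π))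
    × length L ≡ N

IsInverse : ∀ {k} → Vec (Fin k) k → Vec (Fin k) k → Set
IsInverse {k} σ τ = ∀ (j : Fin k) → lookup τ (lookup σ j) ≡ j

-- p^r : reverse σ, X ↦ {k - x}  (reversing the subset vector realises x ↦ k - x)
patR : ∀ {k} → Pattern k → Pattern k
patR (pat s x y) = pat (reverse s) (reverse x) y

-- p^c : complement σ, Y ↦ {k - y}
patC : ∀ {k} → Pattern k → Pattern k
patC (pat s x y) = pat (map opposite s) x (reverse y)

data SymClass {k : ℕ} (p : Pattern k) : Pattern k → Set where
  sym-base : SymClass p p
  sym-i    : ∀ {q} (τ : Vec (Fin k) k) → SymClass p q → IsInverse (σ q) τ →
             SymClass p (pat τ (Y q) (X q))
  sym-r    : ∀ {q} → SymClass p q → SymClass p (patR q)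
  sym-c    : ∀ {q} → SymClass p q → SymClass p (patC q)

f0 f1 f2 : Fin 3
f0 = Fin.zero
f1 = Fin.suc Fin.zero
f2 = Fin.suc (Fin.suc Fin.zero)

s123 s132 : Vec (Fin 3) 3
s123 = f0 ∷ f1 ∷ f2 ∷ []
s132 = f0 ∷ f2 ∷ f1 ∷ []

∅₄ : Subset 4
∅₄ = Data.Fin.Subset.⊥

set0 set2 : Subset 4
set0 = ⁅ Fin.zero ⁆
set2 = ⁅ Fin.suc (Fin.suc Fin.zero) ⁆

data BasePattern : Pattern 3 → Set where
  b1 : BasePattern (pat s123 ∅₄ set0)
  b2 : BasePattern (pat s123 set0 set2)
  b3 : BasePattern (pat s132 ∅₄ set0)
  b4 : BasePattern (pat s132 set0 set2)

formula : ℕ → ℕ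
formula n = sum (List.map (λ j → _/_ ((n ∸ 1) !) (j !) {{j !≢0}}) (upTo n))

module Submission where

-- Reverse, complement and inverse are involutions of the
-- permutations of [n] exchanging occurrences of p with occurrences of p^r,
-- p^c, p^i, so a_n is constant on symmetry classes (avoidCount-symClass).
-- For s = 123 (resp. 132) let ≺ be < (resp. >): π contains (s,∅,{0}) iff
-- a pair π_j ≺ π_l, j < l, lies right of the entry 1.  Splitting π by its
-- first entry gives 1 + n·a_n such avoiders of length n+1 (module Counting),
-- which is the recursion of the sum (formula-rec).  Such a pair can be
-- shrunk to an adjacent one, so (s,{2},{0}) has the same avoiders, and it
-- is the inverse of (s,{0},{2}) since s is an involution (BasePatterns).

open import Defs
open import Data.Nat as ℕ using (ℕ; zero; suc; _+_; _∸_; _*_; _≥_; z≤n; s≤s; _!)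
import Data.Nat.Properties as ℕP
open import Data.Nat.Properties using (_!≢0)
open import Data.Nat.DivMod using (_/_; *-/-assoc; n/n≡1)
open import Data.Nat.Divisibility using (m≤n⇒m!∣n!)
open import Data.Nat.ListAction using (sum)
open import Data.Nat.ListAction.Properties using (sum-++)
open import Data.Fin as Fin using (Fin; toℕ; opposite; punchIn; punchOut; fromℕ; fromℕ<; inject₁)
import Data.Fin.Properties as FinP
open import Data.Fin.Subset using (Subset) renaming (_∈_ to _∈ₛ_)
open import Data.Fin.Subset.Properties using (x∈⁅y⁆⇒x≡y; x∈⁅x⁆; ∉⊥)
open import Data.Vec as Vec using (Vec; []; _∷_; lookup; reverse; tabulate; _∷ʳ_)
import Data.Vec.Properties as VecP
open import Data.List as List using (List; []; _∷_; length; upTo; allFin; cartesianProductWith; [_]; _++_)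
import Data.List.Properties as ListP
open import Data.List.Membership.Propositional using (_∈_)
open import Data.List.Membership.Propositional.Properties
  using (∈-map⁺; ∈-map⁻; ∈-allFin; ∈-cartesianProductWith⁺; ∈-cartesianProductWith⁻)
import Data.List.Relation.Unary.All as All
open import Data.List.Relation.Unary.All using (All; []; _∷_)
open import Data.List.Relation.Unary.AllPairs using ([]; _∷_)
open import Data.List.Relation.Unary.Any using (here; there)
open import Data.List.Relation.Unary.Unique.Propositional using (Unique)
import Data.List.Relation.Unary.Unique.Propositional.Properties as UniqueP
open import Data.Product using (Σ; _×_; _,_; proj₁; proj₂)
open import Data.Sum using (_⊎_; inj₁; inj₂)
open import Data.Empty using (⊥-elim)
open import Function.Bundles using (_⇔_; mk⇔; Equivalence)
open import Relation.Binary using (tri<; tri≈; tri>)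
open import Relation.Binary.PropositionalEquality hiding ([_])
open import Relation.Nullary using (¬_; Dec; yes; no)

-- factorialQuotients n m = Σ_{j<m} n!/j!, so formula (suc n) is
-- definitionally factorialQuotients n (suc n).
factorialQuotients : ℕ → ℕ → ℕ
factorialQuotients n m = sum (List.map (λ j → _/_ (n !) (j !) {{j !≢0}}) (upTo m))

factorialQuotients-suc : ∀ n m →
  factorialQuotients n (suc m) ≡ factorialQuotients n m + _/_ (n !) (m !) {{m !≢0}}
factorialQuotients-suc n m = begin
  sum (List.map q (upTo (suc m)))         ≡⟨ cong (λ l → sum (List.map q l)) (sym (ListP.upTo-∷ʳ m)) ⟩
  sum (List.map q (upTo m ++ [ m ]))      ≡⟨ cong sum (ListP.map-++ q (upTo m) [ m ]) ⟩
  sum (List.map q (upTo m) ++ [ q m ])    ≡⟨ sum-++ (List.map q (upTo m)) [ q m ] ⟩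
  factorialQuotients n m + (q m + 0)      ≡⟨ cong (factorialQuotients n m +_) (ℕP.+-identityʳ (q m)) ⟩
  factorialQuotients n m + q m            ∎
  where
  open ≡-Reasoning
  q : ℕ → ℕ
  q j = _/_ (n !) (j !) {{j !≢0}}

-- For m ≤ n+1 every quotient (n+1)!/j! with j < m is (n+1)·(n!/j!).
factorialQuotients-scale : ∀ n m → m ℕ.≤ suc n →
  factorialQuotients (suc n) m ≡ suc n * factorialQuotients n m
factorialQuotients-scale n zero _ = sym (ℕP.*-zeroʳ n)
factorialQuotients-scale n (suc m) m<n+1 = begin
  factorialQuotients (suc n) (suc m)
    ≡⟨ factorialQuotients-suc (suc n) m ⟩
  factorialQuotients (suc n) m + _/_ (suc n * n !) (m !) {{m !≢0}}
    ≡⟨ cong₂ _+_ (factorialQuotients-scale n m (ℕP.m≤n⇒m≤1+n m≤n))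
                 (*-/-assoc (suc n) {{m !≢0}} (m≤n⇒m!∣n! m≤n)) ⟩
  suc n * factorialQuotients n m + suc n * _/_ (n !) (m !) {{m !≢0}}
    ≡⟨ sym (ℕP.*-distribˡ-+ (suc n) (factorialQuotients n m) _) ⟩
  suc n * (factorialQuotients n m + _/_ (n !) (m !) {{m !≢0}})
    ≡⟨ cong (suc n *_) (sym (factorialQuotients-suc n m)) ⟩
  suc n * factorialQuotients n (suc m) ∎
  where
  open ≡-Reasoning
  m≤n : m ℕ.≤ n
  m≤n = ℕP.≤-pred m<n+1

-- a_{n+2} = 1 + (n+1)·a_{n+1}: the last summand is (n+1)!/(n+1)! = 1.
formula-rec : ∀ n → formula (suc (suc n)) ≡ suc (suc n * formula (suc n))
formula-rec n = begin
  formula (suc (suc n))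
    ≡⟨ factorialQuotients-suc (suc n) (suc n) ⟩
  factorialQuotients (suc n) (suc n) + _/_ (suc n !) (suc n !) {{suc n !≢0}}
    ≡⟨ cong₂ _+_ (factorialQuotients-scale n (suc n) ℕP.≤-refl) (n/n≡1 (suc n !) {{suc n !≢0}}) ⟩
  suc n * formula (suc n) + 1
    ≡⟨ ℕP.+-comm _ 1 ⟩
  suc (suc n * formula (suc n)) ∎
  where open ≡-Reasoning

vec-ext : ∀ {a} {A : Set a} {n} (xs ys : Vec A n) → (∀ i → lookup xs i ≡ lookup ys i) → xs ≡ ys
vec-ext xs ys h = begin
  xs                 ≡⟨ sym (VecP.tabulate∘lookup xs) ⟩
  tabulate (lookup xs) ≡⟨ VecP.tabulate-cong h ⟩
  tabulate (lookup ys) ≡⟨ VecP.tabulate∘lookup ys ⟩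
  ys                 ∎
  where open ≡-Reasoning

lookup-∷ʳ-last : ∀ {a} {A : Set a} {n} (xs : Vec A n) (x : A) → lookup (xs ∷ʳ x) (fromℕ n) ≡ x
lookup-∷ʳ-last []       x = refl
lookup-∷ʳ-last (y ∷ xs) x = lookup-∷ʳ-last xs x

lookup-∷ʳ-inject₁ : ∀ {a} {A : Set a} {n} (xs : Vec A n) (x : A) i →
  lookup (xs ∷ʳ x) (inject₁ i) ≡ lookup xs i
lookup-∷ʳ-inject₁ (y ∷ xs) x Fin.zero    = refl
lookup-∷ʳ-inject₁ (y ∷ xs) x (Fin.suc i) = lookup-∷ʳ-inject₁ xs x i

lookup-reverse-opposite : ∀ {a} {A : Set a} {n} (xs : Vec A n) i →
  lookup (reverse xs) (opposite i) ≡ lookup xs i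
lookup-reverse-opposite {n = suc n} (x ∷ xs) Fin.zero = begin
  lookup (reverse (x ∷ xs)) (fromℕ n) ≡⟨ cong (λ v → lookup v (fromℕ n)) (VecP.reverse-∷ x xs) ⟩
  lookup (reverse xs ∷ʳ x) (fromℕ n)  ≡⟨ lookup-∷ʳ-last (reverse xs) x ⟩
  x                                   ∎
  where open ≡-Reasoning
lookup-reverse-opposite {n = suc n} (x ∷ xs) (Fin.suc i) = begin
  lookup (reverse (x ∷ xs)) (inject₁ (opposite i)) ≡⟨ cong (λ v → lookup v (inject₁ (opposite i))) (VecP.reverse-∷ x xs) ⟩
  lookup (reverse xs ∷ʳ x) (inject₁ (opposite i))  ≡⟨ lookup-∷ʳ-inject₁ (reverse xs) x (opposite i) ⟩
  lookup (reverse xs) (opposite i)                 ≡⟨ lookup-reverse-opposite xs i ⟩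
  lookup xs i                                      ∎
  where open ≡-Reasoning

lookup-reverse : ∀ {a} {A : Set a} {n} (xs : Vec A n) i → lookup (reverse xs) i ≡ lookup xs (opposite i)
lookup-reverse xs i = begin
  lookup (reverse xs) i                       ≡⟨ cong (lookup (reverse xs)) (sym (FinP.opposite-involutive i)) ⟩
  lookup (reverse xs) (opposite (opposite i)) ≡⟨ lookup-reverse-opposite xs (opposite i) ⟩
  lookup xs (opposite i)                      ∎
  where open ≡-Reasoning

opposite-injective : ∀ {n} (i j : Fin n) → opposite i ≡ opposite j → i ≡ j
opposite-injective i j e =
  trans (sym (FinP.opposite-involutive i)) (trans (cong opposite e) (FinP.opposite-involutive j))

-- An injective endomap of Fin n is surjective (pigeonhole: otherwise it
-- would inject Fin (suc m) into Fin m by punching out the missed value).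
injective⇒surjective : ∀ {n} (f : Fin n → Fin n) → (∀ i j → f i ≡ f j → i ≡ j) →
  ∀ v → Σ (Fin n) λ i → f i ≡ v
injective⇒surjective {zero}  f inj ()
injective⇒surjective {suc n} f inj v with FinP.any? (λ i → f i FinP.≟ v)
... | yes hit = hit
... | no miss = ⊥-elim (ℕP.<-irrefl refl (FinP.injective⇒≤ {f = squeeze} squeeze-injective))
  where
  squeeze : Fin (suc n) → Fin n
  squeeze i = punchOut {i = v} {j = f i} (λ e → miss (i , sym e))
  squeeze-injective : ∀ {i j} → squeeze i ≡ squeeze j → i ≡ j
  squeeze-injective {i} {j} e =
    inj i j (FinP.punchOut-injective (λ e′ → miss (i , sym e′)) (λ e′ → miss (j , sym e′)) e)

positionOf : ∀ {n} → Vec (Fin n) n → Fin n → Fin n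
positionOf π v with FinP.any? (λ i → lookup π i FinP.≟ v)
... | yes (i , _) = i
... | no _        = v

lookup-positionOf : ∀ {n} (π : Vec (Fin n) n) → IsPerm π → ∀ v → lookup π (positionOf π v) ≡ v
lookup-positionOf π π-perm v with FinP.any? (λ i → lookup π i FinP.≟ v)
... | yes (i , e) = e
... | no miss     = ⊥-elim (miss (injective⇒surjective (lookup π) π-perm v))

positionOf-lookup : ∀ {n} (π : Vec (Fin n) n) → IsPerm π → ∀ i → positionOf π (lookup π i) ≡ i
positionOf-lookup π π-perm i = π-perm _ _ (lookup-positionOf π π-perm (lookup π i))

inverse : ∀ {n} → Vec (Fin n) n → Vec (Fin n) n
inverse π = tabulate (positionOf π)

lookup-inverse : ∀ {n} (π : Vec (Fin n) n) v → lookup (inverse π) v ≡ positionOf π v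
lookup-inverse π = VecP.lookup∘tabulate (positionOf π)

inverse-isPerm : ∀ {n} (π : Vec (Fin n) n) → IsPerm π → IsPerm (inverse π)
inverse-isPerm π π-perm u v e = begin
  u                                 ≡⟨ sym (lookup-positionOf π π-perm u) ⟩
  lookup π (positionOf π u)         ≡⟨ cong (lookup π) (trans (sym (lookup-inverse π u)) (trans e (lookup-inverse π v))) ⟩
  lookup π (positionOf π v)         ≡⟨ lookup-positionOf π π-perm v ⟩
  v                                 ∎
  where open ≡-Reasoning

inverse-involutive : ∀ {n} (π : Vec (Fin n) n) → IsPerm π → inverse (inverse π) ≡ π
inverse-involutive π π-perm = vec-ext _ _ λ i → inverse-isPerm π π-perm _ _ (begin
  lookup (inverse π) (lookup (inverse (inverse π)) i)     ≡⟨ cong (lookup (inverse π)) (lookup-inverse (inverse π) i) ⟩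
  lookup (inverse π) (positionOf (inverse π) i)           ≡⟨ lookup-positionOf (inverse π) (inverse-isPerm π π-perm) i ⟩
  i                                                       ≡⟨ sym (positionOf-lookup π π-perm i) ⟩
  positionOf π (lookup π i)                               ≡⟨ sym (lookup-inverse π (lookup π i)) ⟩
  lookup (inverse π) (lookup π i)                         ∎)
  where open ≡-Reasoning

complement : ∀ {m n} → Vec (Fin n) m → Vec (Fin n) m
complement = Vec.map opposite

complement-involutive : ∀ {m n} (π : Vec (Fin n) m) → complement (complement π) ≡ π
complement-involutive π = vec-ext _ _ λ i → begin
  lookup (complement (complement π)) i ≡⟨ VecP.lookup-map i opposite (complement π) ⟩
  opposite (lookup (complement π) i)   ≡⟨ cong opposite (VecP.lookup-map i opposite π) ⟩
  opposite (opposite (lookup π i))     ≡⟨ FinP.opposite-involutive _ ⟩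
  lookup π i                           ∎
  where open ≡-Reasoning

complement-isPerm : ∀ {n} (π : Vec (Fin n) n) → IsPerm π → IsPerm (complement π)
complement-isPerm π π-perm i j e = π-perm i j (opposite-injective _ _
  (trans (sym (VecP.lookup-map i opposite π)) (trans e (VecP.lookup-map j opposite π))))

reverse-isPerm : ∀ {n} (π : Vec (Fin n) n) → IsPerm π → IsPerm (reverse π)
reverse-isPerm π π-perm i j e = opposite-injective i j
  (π-perm _ _ (trans (sym (lookup-reverse π i)) (trans e (lookup-reverse π j))))

IsInverse⇒injective : ∀ {k} (s τ : Vec (Fin k) k) → IsInverse s τ → ∀ a b → lookup s a ≡ lookup s b → a ≡ b
IsInverse⇒injective s τ τ∘s≡id a b e = trans (sym (τ∘s≡id a)) (trans (cong (lookup τ) e) (τ∘s≡id b))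

IsInverse-sym : ∀ {k} (s τ : Vec (Fin k) k) → IsInverse s τ → IsInverse τ s
IsInverse-sym s τ τ∘s≡id m with injective⇒surjective (lookup s) (IsInverse⇒injective s τ τ∘s≡id) m
... | j , refl = cong (lookup s) (τ∘s≡id j)

PermCount : ∀ {n} → (Vec (Fin n) n → Set) → ℕ → Set
PermCount {n} P N =
  Σ (List (Vec (Fin n) n)) λ L →
    Unique L × (∀ π → (π ∈ L) ⇔ (IsPerm π × P π)) × length L ≡ N

unique-map-injectiveOn : ∀ {a b} {A : Set a} {B : Set b} (P : A → Set) (f : A → B) →
  (∀ {x y} → P x → P y → f x ≡ f y → x ≡ y) →
  (xs : List A) → (∀ x → x ∈ xs → P x) → Unique xs → Unique (List.map f xs)
unique-map-injectiveOn P f inj []       _   []            = []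
unique-map-injectiveOn P f inj (x ∷ xs) Pxs (x∉xs ∷ uxs) =
  images-differ xs (λ y m → Pxs y (there m)) x∉xs ∷ unique-map-injectiveOn P f inj xs (λ y m → Pxs y (there m)) uxs
  where
  images-differ : ∀ ys → (∀ y → y ∈ ys → P y) → All (λ y → ¬ x ≡ y) ys → All (λ y → ¬ f x ≡ y) (List.map f ys)
  images-differ []       _   []           = []
  images-differ (y ∷ ys) Pys (x≢y ∷ x∉ys) =
    (λ e → x≢y (inj (Pxs x (here refl)) (Pys y (here refl)) e)) ∷ images-differ ys (λ z m → Pys z (there m)) x∉ys

PermCount-transport : ∀ {n N} {P Q : Vec (Fin n) n → Set} (φ : Vec (Fin n) n → Vec (Fin n) n) →
  (∀ π → IsPerm π → IsPerm (φ π)) →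
  (∀ π → IsPerm π → φ (φ π) ≡ π) →
  (∀ π → IsPerm π → P π → Q (φ π)) →
  (∀ π → IsPerm π → Q π → P (φ π)) →
  PermCount P N → PermCount Q N
PermCount-transport {P = P} {Q} φ φ-perm φ-involutive P⇒Q Q⇒P (L , L-unique , L-members , L-length) =
  List.map φ L ,
  unique-map-injectiveOn IsPerm φ φ-injective L (λ π m → proj₁ (Equivalence.to (L-members π) m)) L-unique ,
  (λ π → mk⇔ (sound π) (complete π)) ,
  trans (ListP.length-map φ L) L-length
  where
  φ-injective : ∀ {π ρ} → IsPerm π → IsPerm ρ → φ π ≡ φ ρ → π ≡ ρ
  φ-injective {π} {ρ} π-perm ρ-perm e = trans (sym (φ-involutive π π-perm)) (trans (cong φ e) (φ-involutive ρ ρ-perm))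
  sound : ∀ π → π ∈ List.map φ L → IsPerm π × Q π
  sound π m with ∈-map⁻ φ m
  ... | ρ , ρ∈L , refl with Equivalence.to (L-members ρ) ρ∈L
  ... | ρ-perm , Pρ = φ-perm ρ ρ-perm , P⇒Q ρ ρ-perm Pρ
  complete : ∀ π → IsPerm π × Q π → π ∈ List.map φ L
  complete π (π-perm , Qπ) = subst (_∈ List.map φ L) (φ-involutive π π-perm)
    (∈-map⁺ φ (Equivalence.from (L-members (φ π)) (φ-perm π π-perm , Q⇒P π π-perm Qπ)))

PermCount-cong : ∀ {n N} {P Q : Vec (Fin n) n → Set} →
  (∀ π → IsPerm π → P π → Q π) → (∀ π → IsPerm π → Q π → P π) → PermCount P N → PermCount Q N
PermCount-cong {P = P} {Q} P⇒Q Q⇒P (L , L-unique , L-members , L-length) =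
  L , L-unique , (λ π → mk⇔ (sound π) (complete π)) , L-length
  where
  sound : ∀ π → π ∈ L → IsPerm π × Q π
  sound π m with Equivalence.to (L-members π) m
  ... | π-perm , Pπ = π-perm , P⇒Q π π-perm Pπ
  complete : ∀ π → IsPerm π × Q π → π ∈ L
  complete π (π-perm , Qπ) = Equivalence.from (L-members π) (π-perm , Q⇒P π π-perm Qπ)

reflect-successor : ∀ a u v → u ℕ.≤ a → v ℕ.≤ a → a ∸ u ≡ suc (a ∸ v) → v ≡ suc u
reflect-successor a u v u≤a v≤a e = ℕP.+-cancelˡ-≡ (a ∸ v) v (suc u) (begin
  (a ∸ v) + v     ≡⟨ ℕP.m∸n+n≡m v≤a ⟩
  a               ≡⟨ sym (ℕP.m∸n+n≡m u≤a) ⟩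
  (a ∸ u) + u     ≡⟨ cong (_+ u) e ⟩
  suc (a ∸ v) + u ≡⟨ sym (ℕP.+-suc (a ∸ v) u) ⟩
  (a ∸ v) + suc u ∎)
  where open ≡-Reasoning

opposite-< : ∀ {n} {a b : Fin n} → a Fin.< b → opposite b Fin.< opposite a
opposite-< {n} {a} {b} a<b = subst₂ ℕ._<_ (sym (FinP.opposite-prop b)) (sym (FinP.opposite-prop a))
  (ℕP.∸-monoʳ-< (s≤s a<b) (FinP.toℕ<n b))

opposite-<-reflect : ∀ {n} {a b : Fin n} → opposite a Fin.< opposite b → b Fin.< a
opposite-<-reflect {n} {a} {b} h =
  subst₂ Fin._<_ (FinP.opposite-involutive b) (FinP.opposite-involutive a) (opposite-< h)

∸-toℕ : ∀ {m} (x : Fin m) → m ∸ toℕ x ≡ suc (toℕ (opposite x))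
∸-toℕ {suc m} x = trans (ℕP.+-∸-assoc 1 (ℕ.s≤s⁻¹ (FinP.toℕ<n x))) (cong suc (sym (FinP.opposite-prop x)))

∸-opposite : ∀ {n} (z : Fin n) → n ∸ toℕ (opposite z) ≡ suc (toℕ z)
∸-opposite {n} z = trans (cong (n ∸_) (FinP.opposite-prop z)) (ℕP.m∸[m∸n]≡n (FinP.toℕ<n z))

∈-reverse : ∀ {k} (S : Subset (suc k)) (x : Fin (suc k)) → x ∈ₛ reverse S → opposite x ∈ₛ S
∈-reverse S x x∈ = VecP.lookup⇒[]= (opposite x) S (trans (sym (lookup-reverse S x)) (VecP.[]=⇒lookup x∈))

Monotone : ∀ {k n} → (Fin k → Fin n) → Set
Monotone ι = ∀ a b → a Fin.< b → ι a Fin.< ι b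

monotone-reflects-< : ∀ {k n} (ι : Fin k → Fin n) → Monotone ι → ∀ a b → ι a Fin.< ι b → a Fin.< b
monotone-reflects-< ι ι-mono a b h with FinP.<-cmp a b
... | tri< a<b _ _    = a<b
... | tri≈ _ refl _   = ⊥-elim (FinP.<-irrefl refl h)
... | tri> _ _ b<a    = ⊥-elim (FinP.<-asym h (ι-mono b a b<a))

module _ {k n} {p : Pattern k} {π : Vec (Fin n) n} {ι : Fin k → Fin n} where

  IIs-bound : ∀ {m u} → IIs p π ι m u → u ℕ.≤ suc n
  IIs-bound i-zero    = z≤n
  IIs-bound (i-mid a) = s≤s (FinP.toℕ≤n _)
  IIs-bound i-top     = ℕP.≤-refl

  JIs-bound : ∀ {m u} → JIs p π ι m u → u ℕ.≤ suc n
  JIs-bound j-zero    = z≤n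
  JIs-bound (j-mid a) = s≤s (FinP.toℕ≤n _)
  JIs-bound j-top     = ℕP.≤-refl

-- Reverse: if ι is an occurrence of (s,X,Y) in π, then a ↦ n-1-ι(k-1-a)
-- is an occurrence of (s^r, X^r, Y) in π^r; position indices are
-- reflected (i'_m = n+1 - i_{k+1-m}) and value indices are unchanged.
module ReverseOccurrence {k n} (s : Vec (Fin k) k) (X Y : Subset (suc k)) (π : Vec (Fin n) n) (ι : Fin k → Fin n) where
  p p′ : Pattern k
  p  = pat s X Y
  p′ = pat (reverse s) (reverse X) Y

  ι′ : Fin k → Fin n
  ι′ a = opposite (ι (opposite a))

  IIs-reflect : ∀ {m u} → IIs p′ (reverse π) ι′ m u → IIs p π ι (suc k ∸ m) (suc n ∸ u)
  IIs-reflect i-zero = i-top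
  IIs-reflect i-top  = subst₂ (IIs p π ι) (sym (ℕP.n∸n≡0 k)) (sym (ℕP.n∸n≡0 n)) i-zero
  IIs-reflect (i-mid a) = subst₂ (IIs p π ι)
    (sym (∸-toℕ a))
    (sym (∸-opposite (ι (opposite a))))
    (i-mid (opposite a))

  JIs-same : ∀ {m u} → JIs p′ (reverse π) ι′ m u → JIs p π ι m u
  JIs-same j-zero    = j-zero
  JIs-same j-top     = j-top
  JIs-same (j-mid a) = subst₂ (JIs p π ι)
    (cong (λ z → suc (toℕ z)) (sym (lookup-reverse s a)))
    (cong (λ z → suc (toℕ z)) (sym (lookup-reverse-opposite π (ι (opposite a)))))
    (j-mid (opposite a))

  occurrence : Occurrence p π ι → Occurrence p′ (reverse π) ι′
  occurrence (ι-mono , ι-iso , X-adj , Y-adj) = ι′-mono , ι′-iso , X′-adj , Y-adj′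
    where
    ι′-mono : Monotone ι′
    ι′-mono a b a<b = opposite-< (ι-mono _ _ (opposite-< a<b))
    ι′-iso : ∀ a b → (lookup (reverse s) a Fin.< lookup (reverse s) b → lookup (reverse π) (ι′ a) Fin.< lookup (reverse π) (ι′ b))
                   × (lookup (reverse π) (ι′ a) Fin.< lookup (reverse π) (ι′ b) → lookup (reverse s) a Fin.< lookup (reverse s) b)
    ι′-iso a b rewrite lookup-reverse s a | lookup-reverse s b
                     | lookup-reverse-opposite π (ι (opposite a)) | lookup-reverse-opposite π (ι (opposite b))
      = ι-iso (opposite a) (opposite b)
    X′-adj : ∀ (x : Fin (suc k)) → x ∈ₛ reverse X → ∀ u v →
             IIs p′ (reverse π) ι′ (toℕ x) u → IIs p′ (reverse π) ι′ (suc (toℕ x)) v → v ≡ suc u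
    X′-adj x x∈ u v iu iv = reflect-successor (suc n) u v (IIs-bound iu) (IIs-bound iv)
      (X-adj (opposite x) (∈-reverse X x x∈) _ _
        (subst (λ z → IIs p π ι z (suc n ∸ v)) (sym (FinP.opposite-prop x)) (IIs-reflect iv))
        (subst (λ z → IIs p π ι z (suc n ∸ u)) (∸-toℕ x) (IIs-reflect iu)))
    Y-adj′ : ∀ (y : Fin (suc k)) → y ∈ₛ Y → ∀ u v →
             JIs p′ (reverse π) ι′ (toℕ y) u → JIs p′ (reverse π) ι′ (suc (toℕ y)) v → v ≡ suc u
    Y-adj′ y y∈ u v ju jv = Y-adj y y∈ u v (JIs-same ju) (JIs-same jv)

contains-reverse : ∀ {k n} (s : Vec (Fin k) k) (X Y : Subset (suc k)) (π : Vec (Fin n) n) →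
  Contains (pat s X Y) π → Contains (pat (reverse s) (reverse X) Y) (reverse π)
contains-reverse s X Y π (ι , occ) = ReverseOccurrence.ι′ s X Y π ι , ReverseOccurrence.occurrence s X Y π ι occ

-- Complement: the same ι is an occurrence of (s^c, X, Y^c) in π^c;
-- value indices are reflected (j'_m = n+1 - j_{k+1-m}).
module ComplementOccurrence {k n} (s : Vec (Fin k) k) (X Y : Subset (suc k)) (π : Vec (Fin n) n) (ι : Fin k → Fin n) where
  p p′ : Pattern k
  p  = pat s X Y
  p′ = pat (complement s) X (reverse Y)

  IIs-same : ∀ {m u} → IIs p′ (complement π) ι m u → IIs p π ι m u
  IIs-same i-zero    = i-zero
  IIs-same i-top     = i-top
  IIs-same (i-mid a) = i-mid a

  suc-toℕ-complement : ∀ {r m} (xs : Vec (Fin r) m) i → r ∸ toℕ (lookup (complement xs) i) ≡ suc (toℕ (lookup xs i))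
  suc-toℕ-complement {r} xs i = trans (cong (λ z → r ∸ toℕ z) (VecP.lookup-map i opposite xs)) (∸-opposite (lookup xs i))

  JIs-reflect : ∀ {m u} → JIs p′ (complement π) ι m u → JIs p π ι (suc k ∸ m) (suc n ∸ u)
  JIs-reflect j-zero    = j-top
  JIs-reflect j-top     = subst₂ (JIs p π ι) (sym (ℕP.n∸n≡0 k)) (sym (ℕP.n∸n≡0 n)) j-zero
  JIs-reflect (j-mid a) = subst₂ (JIs p π ι)
    (sym (suc-toℕ-complement s a)) (sym (suc-toℕ-complement π (ι a))) (j-mid a)

  occurrence : Occurrence p π ι → Occurrence p′ (complement π) ι
  occurrence (ι-mono , ι-iso , X-adj , Y-adj) = ι-mono , ι-iso′ , X-adj′ , Y′-adj
    where
    ι-iso′ : ∀ a b → (lookup (complement s) a Fin.< lookup (complement s) b → lookup (complement π) (ι a) Fin.< lookup (complement π) (ι b))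
                   × (lookup (complement π) (ι a) Fin.< lookup (complement π) (ι b) → lookup (complement s) a Fin.< lookup (complement s) b)
    ι-iso′ a b rewrite VecP.lookup-map a opposite s | VecP.lookup-map b opposite s
                     | VecP.lookup-map (ι a) opposite π | VecP.lookup-map (ι b) opposite π
      = (λ h → opposite-< (proj₁ (ι-iso b a) (opposite-<-reflect h)))
      , (λ h → opposite-< (proj₂ (ι-iso b a) (opposite-<-reflect h)))
    X-adj′ : ∀ (x : Fin (suc k)) → x ∈ₛ X → ∀ u v →
             IIs p′ (complement π) ι (toℕ x) u → IIs p′ (complement π) ι (suc (toℕ x)) v → v ≡ suc u
    X-adj′ x x∈ u v iu iv = X-adj x x∈ u v (IIs-same iu) (IIs-same iv)
    Y′-adj : ∀ (y : Fin (suc k)) → y ∈ₛ reverse Y → ∀ u v →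
             JIs p′ (complement π) ι (toℕ y) u → JIs p′ (complement π) ι (suc (toℕ y)) v → v ≡ suc u
    Y′-adj y y∈ u v ju jv = reflect-successor (suc n) u v (JIs-bound ju) (JIs-bound jv)
      (Y-adj (opposite y) (∈-reverse Y y y∈) _ _
        (subst (λ z → JIs p π ι z (suc n ∸ v)) (sym (FinP.opposite-prop y)) (JIs-reflect jv))
        (subst (λ z → JIs p π ι z (suc n ∸ u)) (∸-toℕ y) (JIs-reflect ju)))

contains-complement : ∀ {k n} (s : Vec (Fin k) k) (X Y : Subset (suc k)) (π : Vec (Fin n) n) →
  Contains (pat s X Y) π → Contains (pat (complement s) X (reverse Y)) (complement π)
contains-complement s X Y π (ι , occ) = ι , ComplementOccurrence.occurrence s X Y π ι occ

-- Inverse: a ↦ π(ι(τ a)) is an occurrence of (τ, Y, X) in π⁻¹ when τ = s⁻¹;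
-- positions and values, hence the constraints X and Y, trade places.
module InverseOccurrence {k n} (s τ : Vec (Fin k) k) (X Y : Subset (suc k)) (π : Vec (Fin n) n) (ι : Fin k → Fin n)
         (τ∘s≡id : IsInverse s τ) (s∘τ≡id : IsInverse τ s) (π-perm : IsPerm π) where
  p p′ : Pattern k
  p  = pat s X Y
  p′ = pat τ Y X

  ι′ : Fin k → Fin n
  ι′ m = lookup π (ι (lookup τ m))

  lookup-inverse-ι′ : ∀ m → lookup (inverse π) (ι′ m) ≡ ι (lookup τ m)
  lookup-inverse-ι′ m = trans (lookup-inverse π _) (positionOf-lookup π π-perm _)

  IIs⇒JIs : ∀ {m u} → IIs p′ (inverse π) ι′ m u → JIs p π ι m u
  IIs⇒JIs i-zero    = j-zero
  IIs⇒JIs i-top     = j-top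
  IIs⇒JIs (i-mid m) = subst (λ z → JIs p π ι (suc (toℕ z)) (suc (toℕ (ι′ m)))) (s∘τ≡id m) (j-mid (lookup τ m))

  JIs⇒IIs : ∀ {m u} → JIs p′ (inverse π) ι′ m u → IIs p π ι m u
  JIs⇒IIs j-zero    = i-zero
  JIs⇒IIs j-top     = i-top
  JIs⇒IIs (j-mid a) = subst (λ z → IIs p π ι (suc (toℕ (lookup τ a))) (suc (toℕ z))) (sym (lookup-inverse-ι′ a))
    (i-mid (lookup τ a))

  occurrence : Occurrence p π ι → Occurrence p′ (inverse π) ι′
  occurrence (ι-mono , ι-iso , X-adj , Y-adj) = ι′-mono , ι′-iso , Y-adj′ , X-adj′
    where
    ι′-mono : Monotone ι′
    ι′-mono a b a<b = proj₁ (ι-iso (lookup τ a) (lookup τ b)) (subst₂ Fin._<_ (sym (s∘τ≡id a)) (sym (s∘τ≡id b)) a<b)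
    ι′-iso : ∀ a b → (lookup τ a Fin.< lookup τ b → lookup (inverse π) (ι′ a) Fin.< lookup (inverse π) (ι′ b))
                   × (lookup (inverse π) (ι′ a) Fin.< lookup (inverse π) (ι′ b) → lookup τ a Fin.< lookup τ b)
    ι′-iso a b rewrite lookup-inverse-ι′ a | lookup-inverse-ι′ b = ι-mono _ _ , monotone-reflects-< ι ι-mono _ _
    Y-adj′ : ∀ (x : Fin (suc k)) → x ∈ₛ Y → ∀ u v →
             IIs p′ (inverse π) ι′ (toℕ x) u → IIs p′ (inverse π) ι′ (suc (toℕ x)) v → v ≡ suc u
    Y-adj′ x x∈ u v iu iv = Y-adj x x∈ u v (IIs⇒JIs iu) (IIs⇒JIs iv)
    X-adj′ : ∀ (y : Fin (suc k)) → y ∈ₛ X → ∀ u v →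
             JIs p′ (inverse π) ι′ (toℕ y) u → JIs p′ (inverse π) ι′ (suc (toℕ y)) v → v ≡ suc u
    X-adj′ y y∈ u v ju jv = X-adj y y∈ u v (JIs⇒IIs ju) (JIs⇒IIs jv)

contains-inverse : ∀ {k n} (s τ : Vec (Fin k) k) (X Y : Subset (suc k)) (π : Vec (Fin n) n) →
  IsInverse s τ → IsPerm π → Contains (pat s X Y) π → Contains (pat τ Y X) (inverse π)
contains-inverse s τ X Y π τ∘s≡id π-perm (ι , occ) =
  InverseOccurrence.ι′ s τ X Y π ι τ∘s≡id s∘τ≡id π-perm ,
  InverseOccurrence.occurrence s τ X Y π ι τ∘s≡id s∘τ≡id π-perm occ
  where
  s∘τ≡id : IsInverse τ s
  s∘τ≡id = IsInverse-sym s τ τ∘s≡id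

avoidCount-involution : ∀ {k n N} (p q : Pattern k) (φ : Vec (Fin n) n → Vec (Fin n) n) →
  (∀ π → IsPerm π → IsPerm (φ π)) → (∀ π → IsPerm π → φ (φ π) ≡ π) →
  (∀ π → IsPerm π → Contains q (φ π) → Contains p π) →
  (∀ π → IsPerm π → Contains p (φ π) → Contains q π) →
  AvoidCount p n N → AvoidCount q n N
avoidCount-involution p q φ φ-perm φ-involutive q-at-φ p-at-φ =
  PermCount-transport φ φ-perm φ-involutive
    (λ π π-perm avoids c → avoids (q-at-φ π π-perm c))
    (λ π π-perm avoids c → avoids (p-at-φ π π-perm c))

avoidCount-r : ∀ {k n N} (q : Pattern k) → AvoidCount q n N → AvoidCount (patR q) n N
avoidCount-r q = avoidCount-involution q (patR q) reverse reverse-isPerm (λ π _ → VecP.reverse-involutive π)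
  (λ π _ c → subst₂ Contains
     (cong₂ (λ s x → pat s x (Y q)) (VecP.reverse-involutive (σ q)) (VecP.reverse-involutive (X q)))
     (VecP.reverse-involutive π)
     (contains-reverse (reverse (σ q)) (reverse (X q)) (Y q) (reverse π) c))
  (λ π _ c → subst (Contains (patR q)) (VecP.reverse-involutive π)
     (contains-reverse (σ q) (X q) (Y q) (reverse π) c))

avoidCount-c : ∀ {k n N} (q : Pattern k) → AvoidCount q n N → AvoidCount (patC q) n N
avoidCount-c q = avoidCount-involution q (patC q) complement complement-isPerm (λ π _ → complement-involutive π)
  (λ π _ c → subst₂ Contains
     (cong₂ (λ s y → pat s (X q) y) (complement-involutive (σ q)) (VecP.reverse-involutive (Y q)))
     (complement-involutive π)
     (contains-complement (complement (σ q)) (X q) (reverse (Y q)) (complement π) c))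
  (λ π _ c → subst (Contains (patC q)) (complement-involutive π)
     (contains-complement (σ q) (X q) (Y q) (complement π) c))

avoidCount-i : ∀ {k n N} (q : Pattern k) (τ : Vec (Fin k) k) → IsInverse (σ q) τ →
  AvoidCount q n N → AvoidCount (pat τ (Y q) (X q)) n N
avoidCount-i q τ τ∘σ≡id = avoidCount-involution q (pat τ (Y q) (X q)) inverse inverse-isPerm inverse-involutive
  (λ π π-perm c → subst (Contains q) (inverse-involutive π π-perm)
     (contains-inverse τ (σ q) (Y q) (X q) (inverse π) (IsInverse-sym (σ q) τ τ∘σ≡id) (inverse-isPerm π π-perm) c))
  (λ π π-perm c → subst (Contains (pat τ (Y q) (X q))) (inverse-involutive π π-perm)
     (contains-inverse (σ q) τ (X q) (Y q) (inverse π) τ∘σ≡id (inverse-isPerm π π-perm) c))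

avoidCount-symClass : ∀ {k n N} {b p : Pattern k} → SymClass b p → AvoidCount b n N → AvoidCount p n N
avoidCount-symClass sym-base                count = count
avoidCount-symClass (sym-i {q} τ q∈ τ∘σ≡id) count = avoidCount-i q τ τ∘σ≡id (avoidCount-symClass q∈ count)
avoidCount-symClass (sym-r {q} q∈)          count = avoidCount-r q (avoidCount-symClass q∈ count)
avoidCount-symClass (sym-c {q} q∈)          count = avoidCount-c q (avoidCount-symClass q∈ count)

ins : ∀ {n} → Fin (suc n) → Vec (Fin n) n → Vec (Fin (suc n)) (suc n)
ins v t = v ∷ Vec.map (punchIn v) t

lookup-ins : ∀ {n} (v : Fin (suc n)) (t : Vec (Fin n) n) i → lookup (ins v t) (Fin.suc i) ≡ punchIn v (lookup t i)
lookup-ins v t i = VecP.lookup-map i (punchIn v) t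

ins-isPerm : ∀ {n} (v : Fin (suc n)) (t : Vec (Fin n) n) → IsPerm t → IsPerm (ins v t)
ins-isPerm v t t-perm Fin.zero    Fin.zero    e = refl
ins-isPerm v t t-perm Fin.zero    (Fin.suc j) e = ⊥-elim (FinP.punchInᵢ≢i v (lookup t j) (sym (trans e (lookup-ins v t j))))
ins-isPerm v t t-perm (Fin.suc i) Fin.zero    e = ⊥-elim (FinP.punchInᵢ≢i v (lookup t i) (trans (sym (lookup-ins v t i)) e))
ins-isPerm v t t-perm (Fin.suc i) (Fin.suc j) e =
  cong Fin.suc (t-perm i j (FinP.punchIn-injective v _ _ (trans (sym (lookup-ins v t i)) (trans e (lookup-ins v t j)))))

ins-injective : ∀ {n} {v v′ : Fin (suc n)} {t t′ : Vec (Fin n) n} → ins v t ≡ ins v′ t′ → v ≡ v′ × t ≡ t′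
ins-injective {v = v} {t = t} {t′} e with VecP.∷-injective e
... | refl , rest≡ = refl , vec-ext t t′ (λ i → FinP.punchIn-injective v _ _
      (trans (sym (lookup-ins v t i)) (trans (cong (λ z → lookup z i) rest≡) (lookup-ins v t′ i))))

decompose : ∀ {n} (π : Vec (Fin (suc n)) (suc n)) → IsPerm π →
  Σ (Vec (Fin n) n) λ t → IsPerm t × π ≡ ins (lookup π Fin.zero) t
decompose {n} (v ∷ rest) π-perm = t , t-perm , cong (v ∷_) (vec-ext _ _ λ i → sym (begin
    lookup (Vec.map (punchIn v) t) i ≡⟨ VecP.lookup-map i (punchIn v) t ⟩
    punchIn v (lookup t i)           ≡⟨ cong (punchIn v) (VecP.lookup∘tabulate standardise i) ⟩
    punchIn v (standardise i)        ≡⟨ FinP.punchIn-punchOut (v≢rest i) ⟩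
    lookup rest i                    ∎))
  where
  open ≡-Reasoning
  v≢rest : ∀ i → ¬ v ≡ lookup rest i
  v≢rest i e with π-perm Fin.zero (Fin.suc i) e
  ... | ()
  standardise : Fin n → Fin n
  standardise i = punchOut (v≢rest i)
  t : Vec (Fin n) n
  t = tabulate standardise
  t-perm : IsPerm t
  t-perm i j e = FinP.suc-injective (π-perm (Fin.suc i) (Fin.suc j) (FinP.punchOut-injective (v≢rest i) (v≢rest j)
    (trans (sym (VecP.lookup∘tabulate standardise i)) (trans e (VecP.lookup∘tabulate standardise j)))))

-- What the counting argument needs of < (and, dually, of >): a decidable
-- relation on every Fin n, compatible with punchIn, with an element top
-- that every other element is below and that is below nothing.
record Comparison : Set₁ where
  field
    _≺_                 : ∀ {n} → Fin n → Fin n → Set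
    _≺?_                : ∀ {n} (a b : Fin n) → Dec (a ≺ b)
    ≺-step              : ∀ {n} (a b c : Fin n) → ¬ a ≺ b → a ≺ c → b ≺ c
    punchIn-reflects-≺  : ∀ {n} (v : Fin (suc n)) a b → punchIn v a ≺ punchIn v b → a ≺ b
    punchIn-preserves-≺ : ∀ {n} (v : Fin (suc n)) a b → a ≺ b → punchIn v a ≺ punchIn v b
    top                 : ∀ n → Fin (suc n)
    ≺-top               : ∀ {n} (v : Fin (suc n)) → ¬ v ≡ top n → v ≺ top n
    top-maximal         : ∀ {n} (x : Fin (suc n)) → ¬ top n ≺ x

length-cartesianProductWith : ∀ {a b c} {A : Set a} {B : Set b} {C : Set c} (f : A → B → C) xs ys →
  length (cartesianProductWith f xs ys) ≡ length xs * length ys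
length-cartesianProductWith f []       ys = refl
length-cartesianProductWith f (x ∷ xs) ys = begin
  length (List.map (f x) ys ++ cartesianProductWith f xs ys)        ≡⟨ ListP.length-++ (List.map (f x) ys) ⟩
  length (List.map (f x) ys) + length (cartesianProductWith f xs ys) ≡⟨ cong₂ _+_ (ListP.length-map (f x) ys) (length-cartesianProductWith f xs ys) ⟩
  length ys + length xs * length ys                                  ∎
  where open ≡-Reasoning

module Counting (C : Comparison) where
  open Comparison C

  HasPair : ∀ {n} → Vec (Fin n) n → Set
  HasPair {n} t = Σ (Fin n) λ j → Σ (Fin n) λ l → j Fin.< l × lookup t j ≺ lookup t l

  PairAfterZero : ∀ {n} → Vec (Fin (suc n)) (suc n) → Set
  PairAfterZero {n} t = Σ (Fin (suc n)) λ i → Σ (Fin (suc n)) λ j → Σ (Fin (suc n)) λ l →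
    i Fin.< j × j Fin.< l × lookup t i ≡ Fin.zero × lookup t j ≺ lookup t l

  ≺-ins⁻ : ∀ {n} (v : Fin (suc n)) (t : Vec (Fin n) n) j l →
    lookup (ins v t) (Fin.suc j) ≺ lookup (ins v t) (Fin.suc l) → lookup t j ≺ lookup t l
  ≺-ins⁻ v t j l h = punchIn-reflects-≺ v _ _ (subst₂ _≺_ (lookup-ins v t j) (lookup-ins v t l) h)

  ≺-ins⁺ : ∀ {n} (v : Fin (suc n)) (t : Vec (Fin n) n) j l →
    lookup t j ≺ lookup t l → lookup (ins v t) (Fin.suc j) ≺ lookup (ins v t) (Fin.suc l)
  ≺-ins⁺ v t j l h = subst₂ _≺_ (sym (lookup-ins v t j)) (sym (lookup-ins v t l)) (punchIn-preserves-≺ v _ _ h)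

  hasPair-ins : ∀ {n} (v : Fin (suc n)) (t : Vec (Fin n) n) → HasPair t → HasPair (ins v t)
  hasPair-ins v t (j , l , j<l , r) = Fin.suc j , Fin.suc l , s≤s j<l , ≺-ins⁺ v t j l r

  pairAfterZero-ins-zero⁻ : ∀ {n} (t : Vec (Fin (suc n)) (suc n)) → PairAfterZero (ins Fin.zero t) → HasPair t
  pairAfterZero-ins-zero⁻ t (i , Fin.zero    , l           , ()  , _         , _ , _)
  pairAfterZero-ins-zero⁻ t (i , Fin.suc j   , Fin.zero    , _   , ()        , _ , _)
  pairAfterZero-ins-zero⁻ t (i , Fin.suc j   , Fin.suc l   , _   , s≤s j<l   , _ , r) = j , l , j<l , ≺-ins⁻ Fin.zero t j l r

  pairAfterZero-ins-zero⁺ : ∀ {n} (t : Vec (Fin (suc n)) (suc n)) → HasPair t → PairAfterZero (ins Fin.zero t)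
  pairAfterZero-ins-zero⁺ t (j , l , j<l , r) =
    Fin.zero , Fin.suc j , Fin.suc l , s≤s z≤n , s≤s j<l , refl , ≺-ins⁺ Fin.zero t j l r

  punchIn-suc-zero : ∀ {n} (w x : Fin (suc n)) → punchIn (Fin.suc w) x ≡ Fin.zero → x ≡ Fin.zero
  punchIn-suc-zero w Fin.zero e = refl

  pairAfterZero-ins-suc⁻ : ∀ {n} (w : Fin (suc n)) (t : Vec (Fin (suc n)) (suc n)) → PairAfterZero (ins (Fin.suc w) t) → PairAfterZero t
  pairAfterZero-ins-suc⁻ w t (Fin.zero  , j         , l         , _       , _       , () , _)
  pairAfterZero-ins-suc⁻ w t (Fin.suc i , Fin.zero  , l         , ()      , _       , _  , _)
  pairAfterZero-ins-suc⁻ w t (Fin.suc i , Fin.suc j , Fin.zero  , _       , ()      , _  , _)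
  pairAfterZero-ins-suc⁻ w t (Fin.suc i , Fin.suc j , Fin.suc l , s≤s i<j , s≤s j<l , e  , r) =
    i , j , l , i<j , j<l , punchIn-suc-zero w _ (trans (sym (lookup-ins (Fin.suc w) t i)) e) , ≺-ins⁻ (Fin.suc w) t j l r

  pairAfterZero-ins-suc⁺ : ∀ {n} (w : Fin (suc n)) (t : Vec (Fin (suc n)) (suc n)) → PairAfterZero t → PairAfterZero (ins (Fin.suc w) t)
  pairAfterZero-ins-suc⁺ w t (i , j , l , i<j , j<l , e , r) =
    Fin.suc i , Fin.suc j , Fin.suc l , s≤s i<j , s≤s j<l ,
    trans (lookup-ins (Fin.suc w) t i) (cong (punchIn (Fin.suc w)) e) , ≺-ins⁺ (Fin.suc w) t j l r

  pairFree : ∀ n → Vec (Fin n) n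
  pairFree zero    = []
  pairFree (suc n) = ins (top n) (pairFree n)

  pairFree-isPerm : ∀ n → IsPerm (pairFree n)
  pairFree-isPerm zero    ()
  pairFree-isPerm (suc n) = ins-isPerm (top n) (pairFree n) (pairFree-isPerm n)

  pairFree-noPair : ∀ n → ¬ HasPair (pairFree n)
  pairFree-noPair (suc n) (Fin.zero  , l         , _       , r) = top-maximal _ r
  pairFree-noPair (suc n) (Fin.suc j , Fin.zero  , ()      , r)
  pairFree-noPair (suc n) (Fin.suc j , Fin.suc l , s≤s j<l , r) =
    pairFree-noPair n (j , l , j<l , ≺-ins⁻ (top n) (pairFree n) j l r)

  -- A permutation without ≺-pairs starts with top (else top comes later
  -- and forms a pair with the first entry), so it is pairFree.
  pairFree-unique : ∀ n (t : Vec (Fin n) n) → IsPerm t → ¬ HasPair t → t ≡ pairFree n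
  pairFree-unique zero    []  _      _       = refl
  pairFree-unique (suc n) t t-perm no-pair with decompose t t-perm
  ... | rest , rest-perm , t≡ with lookup t Fin.zero FinP.≟ top n
  ...   | yes first≡top = trans t≡ (cong₂ ins first≡top
          (pairFree-unique n rest rest-perm (λ pr → no-pair (subst HasPair (sym t≡) (hasPair-ins _ rest pr)))))
  ...   | no first≢top with injective⇒surjective (lookup t) t-perm (top n)
  ...     | Fin.zero  , first≡top = ⊥-elim (first≢top first≡top)
  ...     | Fin.suc q , tq≡top    =
            ⊥-elim (no-pair (Fin.zero , Fin.suc q , s≤s z≤n , subst (lookup t Fin.zero ≺_) (sym tq≡top) (≺-top _ first≢top)))

  insSuc : ∀ {n} → Fin (suc n) → Vec (Fin (suc n)) (suc n) → Vec (Fin (suc (suc n))) (suc (suc n))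
  insSuc w = ins (Fin.suc w)

  insSuc-injective : ∀ {n} {w w′ : Fin (suc n)} {t t′} → insSuc w t ≡ insSuc w′ t′ → w ≡ w′ × t ≡ t′
  insSuc-injective e with ins-injective e
  ... | w+1≡ , t≡ = FinP.suc-injective w+1≡ , t≡

  avoiders : ∀ n → List (Vec (Fin (suc n)) (suc n))
  avoiders zero    = (Fin.zero ∷ []) ∷ []
  avoiders (suc n) = ins Fin.zero (pairFree (suc n)) ∷ cartesianProductWith insSuc (allFin (suc n)) (avoiders n)

  avoiders-length : ∀ n → length (avoiders n) ≡ formula (suc n)
  avoiders-length zero    = refl
  avoiders-length (suc n) = begin
    suc (length (cartesianProductWith insSuc (allFin (suc n)) (avoiders n)))
      ≡⟨ cong suc (length-cartesianProductWith insSuc (allFin (suc n)) (avoiders n)) ⟩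
    suc (length (allFin (suc n)) * length (avoiders n))
      ≡⟨ cong₂ (λ a b → suc (a * b)) (ListP.length-tabulate {n = suc n} (λ x → x)) (avoiders-length n) ⟩
    suc (suc n * formula (suc n))
      ≡⟨ sym (formula-rec n) ⟩
    formula (suc (suc n)) ∎
    where open ≡-Reasoning

  avoiders-unique : ∀ n → Unique (avoiders n)
  avoiders-unique zero    = [] ∷ []
  avoiders-unique (suc n) =
    All.tabulate first-differs ∷ UniqueP.cartesianProductWith⁺ insSuc insSuc-injective (UniqueP.allFin⁺ (suc n)) (avoiders-unique n)
    where
    first-differs : ∀ {π} → π ∈ cartesianProductWith insSuc (allFin (suc n)) (avoiders n) → ¬ ins Fin.zero (pairFree (suc n)) ≡ π
    first-differs m e with ∈-cartesianProductWith⁻ insSuc (allFin (suc n)) (avoiders n) m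
    ... | w , t , _ , _ , π≡ with trans e π≡
    ... | ()

  avoiders-sound : ∀ n π → π ∈ avoiders n → IsPerm π × ¬ PairAfterZero π
  avoiders-sound zero    _ (here refl) = (λ { Fin.zero Fin.zero _ → refl }) , λ { (Fin.zero , Fin.zero , _ , () , _) }
  avoiders-sound (suc n) _ (here refl) =
    ins-isPerm Fin.zero (pairFree (suc n)) (pairFree-isPerm (suc n)) ,
    λ c → pairFree-noPair (suc n) (pairAfterZero-ins-zero⁻ (pairFree (suc n)) c)
  avoiders-sound (suc n) π (there m) with ∈-cartesianProductWith⁻ insSuc (allFin (suc n)) (avoiders n) m
  ... | w , t , _ , t∈ , refl with avoiders-sound n t t∈
  ...   | t-perm , t-avoids = ins-isPerm (Fin.suc w) t t-perm , λ c → t-avoids (pairAfterZero-ins-suc⁻ w t c)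

  avoiders-complete : ∀ n π → IsPerm π → ¬ PairAfterZero π → π ∈ avoiders n
  avoiders-complete zero    (Fin.zero ∷ []) _ _ = here refl
  avoiders-complete (suc n) π π-perm π-avoids with decompose π π-perm
  ... | t , t-perm , π≡ = by-first-entry (lookup π Fin.zero) π≡
    where
    by-first-entry : ∀ v → π ≡ ins v t → π ∈ avoiders (suc n)
    by-first-entry Fin.zero    refl = here (cong (ins Fin.zero)
      (pairFree-unique (suc n) t t-perm (λ pr → π-avoids (pairAfterZero-ins-zero⁺ t pr))))
    by-first-entry (Fin.suc w) refl = there (∈-cartesianProductWith⁺ insSuc (∈-allFin w)
      (avoiders-complete n t t-perm (λ c → π-avoids (pairAfterZero-ins-suc⁺ w t c))))

  pairAfterZero-count : ∀ n → PermCount (λ (π : Vec (Fin (suc n)) (suc n)) → ¬ PairAfterZero π) (formula (suc n))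
  pairAfterZero-count n =
    avoiders n , avoiders-unique n ,
    (λ π → mk⇔ (avoiders-sound n π) (λ { (π-perm , π-avoids) → avoiders-complete n π π-perm π-avoids })) ,
    avoiders-length n

  -- An adjacent ≺-pair (j′, j′+1) at or after position j.  Any ≺-pair (j,l)
  -- can be shrunk to one: if t_j ⊀ t_{j+1} then t_{j+1} ≺ t_l by ≺-step,
  -- and (j+1, l) is a shorter pair.
  AdjacentPairFrom : ∀ {n} → Vec (Fin n) n → Fin n → Set
  AdjacentPairFrom {n} t j =
    Σ (Fin n) λ j′ → Σ (Fin n) λ l′ → toℕ l′ ≡ suc (toℕ j′) × toℕ j ℕ.≤ toℕ j′ × lookup t j′ ≺ lookup t l′

  adjacentPair : ∀ {n} (t : Vec (Fin n) n) (j l : Fin n) → j Fin.< l → lookup t j ≺ lookup t l → AdjacentPairFrom t j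
  adjacentPair {n} t j l j<l = shrink (toℕ l ∸ suc (toℕ j)) j l distance
    where
    distance : toℕ l ≡ suc (toℕ l ∸ suc (toℕ j) + toℕ j)
    distance = trans (sym (ℕP.m∸n+n≡m j<l)) (ℕP.+-suc (toℕ l ∸ suc (toℕ j)) (toℕ j))
    shrink : ∀ d (j l : Fin n) → toℕ l ≡ suc (d + toℕ j) → lookup t j ≺ lookup t l → AdjacentPairFrom t j
    shrink zero    j l l≡ r = j , l , l≡ , ℕP.≤-refl , r
    shrink (suc d) j l l≡ r = step (lookup t j ≺? lookup t j+1)
      where
      j<l-by-distance : toℕ j ℕ.< toℕ l
      j<l-by-distance = subst (suc (toℕ j) ℕ.≤_) (sym l≡) (s≤s (ℕP.m≤n+m (toℕ j) (suc d)))
      j+1 : Fin n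
      j+1 = fromℕ< (ℕP.≤-<-trans j<l-by-distance (FinP.toℕ<n l))
      toℕ-j+1 : toℕ j+1 ≡ suc (toℕ j)
      toℕ-j+1 = FinP.toℕ-fromℕ< _
      step : Dec (lookup t j ≺ lookup t j+1) → AdjacentPairFrom t j
      step (yes r₁) = j , j+1 , toℕ-j+1 , ℕP.≤-refl , r₁
      step (no ¬r₁) with shrink d j+1 l
                           (trans l≡ (cong suc (trans (sym (ℕP.+-suc d (toℕ j))) (cong (d +_) (sym toℕ-j+1)))))
                           (≺-step _ _ _ ¬r₁ r)
      ... | j′ , l′ , adjacent , j+1≤j′ , r′ =
            j′ , l′ , adjacent , ℕP.≤-trans (ℕP.n≤1+n (toℕ j)) (subst (ℕ._≤ toℕ j′) toℕ-j+1 j+1≤j′) , r′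

module _ {k n : ℕ} {p : Pattern k} {π : Vec (Fin n) n} {ι : Fin k → Fin n} where

  IIs-view : ∀ {m u} → IIs p π ι m u →
      (m ≡ 0 × u ≡ 0)
    ⊎ (Σ (Fin k) λ a → m ≡ suc (toℕ a) × u ≡ suc (toℕ (ι a)))
    ⊎ (m ≡ suc k × u ≡ suc n)
  IIs-view i-zero    = inj₁ (refl , refl)
  IIs-view (i-mid a) = inj₂ (inj₁ (a , refl , refl))
  IIs-view i-top     = inj₂ (inj₂ (refl , refl))

  JIs-view : ∀ {m u} → JIs p π ι m u →
      (m ≡ 0 × u ≡ 0)
    ⊎ (Σ (Fin k) λ a → m ≡ suc (toℕ (lookup (σ p) a)) × u ≡ suc (toℕ (lookup π (ι a))))
    ⊎ (m ≡ suc k × u ≡ suc n)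
  JIs-view j-zero    = inj₁ (refl , refl)
  JIs-view (j-mid a) = inj₂ (inj₁ (a , refl , refl))
  JIs-view j-top     = inj₂ (inj₂ (refl , refl))

-- Y = {0} says that the smallest value of the occurrence is 1; for σ with
-- σ_1 = 1 that value is taken at the first position of the occurrence.
module _ {n : ℕ} (p : Pattern 3) (π : Vec (Fin (suc n)) (suc n)) (ι : Fin 3 → Fin (suc n))
         (σ-first : lookup (σ p) f0 ≡ Fin.zero) (σ-least : ∀ a → toℕ (lookup (σ p) a) ≡ 0 → a ≡ f0) where

  j₀ : ∀ {u} → JIs p π ι 0 u → u ≡ 0
  j₀ h with JIs-view h
  ... | inj₁ (_ , u≡0)          = u≡0
  ... | inj₂ (inj₁ (a , () , _))
  ... | inj₂ (inj₂ (() , _))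

  j₁ : ∀ {v} → JIs p π ι 1 v → v ≡ suc (toℕ (lookup π (ι f0)))
  j₁ h with JIs-view h
  ... | inj₁ (() , _)
  ... | inj₂ (inj₂ (() , _))
  ... | inj₂ (inj₁ (a , 1≡ , v≡)) with σ-least a (sym (ℕP.suc-injective 1≡))
  ...   | refl = v≡

  Y₀-holds : lookup π (ι f0) ≡ Fin.zero →
    ∀ (y : Fin 4) → y ∈ₛ set0 → ∀ u v → JIs p π ι (toℕ y) u → JIs p π ι (suc (toℕ y)) v → v ≡ suc u
  Y₀-holds least≡0 y y∈ u v ju jv with x∈⁅y⁆⇒x≡y Fin.zero y∈
  ... | refl = trans (j₁ jv) (cong suc (trans (cong toℕ least≡0) (sym (j₀ ju))))

  Y₀-forces : (∀ (y : Fin 4) → y ∈ₛ set0 → ∀ u v → JIs p π ι (toℕ y) u → JIs p π ι (suc (toℕ y)) v → v ≡ suc u) →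
    lookup π (ι f0) ≡ Fin.zero
  Y₀-forces Y-adj = FinP.toℕ-injective (ℕP.suc-injective
    (Y-adj Fin.zero (x∈⁅x⁆ Fin.zero) 0 _ j-zero (subst (λ m → JIs p π ι m (suc (toℕ (lookup π (ι f0))))) (cong (λ z → suc (toℕ z)) σ-first) (j-mid f0))))

-- X = {2} says that the last two entries of the occurrence are adjacent.
module _ {n : ℕ} (p : Pattern 3) (π : Vec (Fin n) n) (ι : Fin 3 → Fin n) where

  i₂ : ∀ {u} → IIs p π ι 2 u → u ≡ suc (toℕ (ι f1))
  i₂ h with IIs-view h
  ... | inj₁ (() , _)
  ... | inj₂ (inj₁ (Fin.zero , () , _))
  ... | inj₂ (inj₁ (Fin.suc Fin.zero , _ , u≡)) = u≡
  ... | inj₂ (inj₁ (Fin.suc (Fin.suc Fin.zero) , () , _))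
  ... | inj₂ (inj₂ (() , _))

  i₃ : ∀ {u} → IIs p π ι 3 u → u ≡ suc (toℕ (ι f2))
  i₃ h with IIs-view h
  ... | inj₁ (() , _)
  ... | inj₂ (inj₁ (Fin.zero , () , _))
  ... | inj₂ (inj₁ (Fin.suc Fin.zero , () , _))
  ... | inj₂ (inj₁ (Fin.suc (Fin.suc Fin.zero) , _ , u≡)) = u≡
  ... | inj₂ (inj₂ (() , _))

  X₂-holds : toℕ (ι f2) ≡ suc (toℕ (ι f1)) →
    ∀ (x : Fin 4) → x ∈ₛ set2 → ∀ u v → IIs p π ι (toℕ x) u → IIs p π ι (suc (toℕ x)) v → v ≡ suc u
  X₂-holds adjacent x x∈ u v iu iv with x∈⁅y⁆⇒x≡y (Fin.suc (Fin.suc Fin.zero)) x∈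
  ... | refl = trans (i₃ iv) (cong suc (trans adjacent (sym (i₂ iu))))

X∅-holds : ∀ {n} (p : Pattern 3) (π : Vec (Fin n) n) (ι : Fin 3 → Fin n) →
  ∀ (x : Fin 4) → x ∈ₛ ∅₄ → ∀ u v → IIs p π ι (toℕ x) u → IIs p π ι (suc (toℕ x)) v → v ≡ suc u
X∅-holds p π ι x x∈ = ⊥-elim (∉⊥ x∈)

OrderIso : ∀ {k n} → Vec (Fin k) k → (Fin k → Fin n) → Set
OrderIso {k} s v = ∀ a b → (lookup s a Fin.< lookup s b → v a Fin.< v b) × (v a Fin.< v b → lookup s a Fin.< lookup s b)

embedding⇒orderIso : ∀ {k n} (s : Vec (Fin k) k) (v : Fin k → Fin n) → (∀ a b → lookup s a ≡ lookup s b → a ≡ b) →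
  (∀ a b → lookup s a Fin.< lookup s b → v a Fin.< v b) → OrderIso s v
embedding⇒orderIso s v s-injective embeds a b = embeds a b , reflects
  where
  reflects : v a Fin.< v b → lookup s a Fin.< lookup s b
  reflects h with FinP.<-cmp (lookup s a) (lookup s b)
  ... | tri< sa<sb _ _ = sa<sb
  ... | tri> _ _ sb<sa = ⊥-elim (FinP.<-asym h (embeds b a sb<sa))
  ... | tri≈ _ sa≡sb _ with s-injective a b sa≡sb
  ...   | refl = ⊥-elim (FinP.<-irrefl refl h)

triple : ∀ {n} → Fin n → Fin n → Fin n → Fin 3 → Fin n
triple i j l a = lookup (i ∷ j ∷ l ∷ []) a

triple-monotone : ∀ {n} {i j l : Fin n} → i Fin.< j → j Fin.< l → Monotone (triple i j l)
triple-monotone i<j j<l Fin.zero                      (Fin.suc Fin.zero)            _ = i<j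
triple-monotone i<j j<l Fin.zero                      (Fin.suc (Fin.suc Fin.zero))  _ = FinP.<-trans i<j j<l
triple-monotone i<j j<l (Fin.suc Fin.zero)            (Fin.suc (Fin.suc Fin.zero))  _ = j<l
triple-monotone i<j j<l Fin.zero                      Fin.zero                     ()
triple-monotone i<j j<l (Fin.suc Fin.zero)            Fin.zero                     ()
triple-monotone i<j j<l (Fin.suc Fin.zero)            (Fin.suc Fin.zero)           (s≤s ())
triple-monotone i<j j<l (Fin.suc (Fin.suc Fin.zero))  Fin.zero                     ()
triple-monotone i<j j<l (Fin.suc (Fin.suc Fin.zero))  (Fin.suc Fin.zero)           (s≤s ())
triple-monotone i<j j<l (Fin.suc (Fin.suc Fin.zero))  (Fin.suc (Fin.suc Fin.zero)) (s≤s (s≤s ()))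

one-below : ∀ {n} (π : Vec (Fin (suc n)) (suc n)) → IsPerm π → ∀ {i x} →
  lookup π i ≡ Fin.zero → ¬ i ≡ x → lookup π i Fin.< lookup π x
one-below π π-perm {i} {x} πi≡0 i≢x with lookup π x in πx≡
... | Fin.zero  = ⊥-elim (i≢x (π-perm i x (trans πi≡0 (sym πx≡))))
... | Fin.suc _ = subst (λ z → toℕ z ℕ.< suc _) (sym πi≡0) (s≤s z≤n)

-- s = 1ab with {a,b} = {2,3} an involution, and ≺ the comparison that
-- realises the order of a and b: ≺-embeds and embedding-≺ say that v
-- realises s exactly when v₁ is least and v₂ ≺ v₃.
module BasePatterns (C : Comparison) (s : Vec (Fin 3) 3) (s-involution : IsInverse s s)
         (s-first : lookup s f0 ≡ Fin.zero) (s-least : ∀ a → toℕ (lookup s a) ≡ 0 → a ≡ f0)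
         (≺-embeds : ∀ {n} (v : Fin 3 → Fin n) → v f0 Fin.< v f1 → v f0 Fin.< v f2 → Comparison._≺_ C (v f1) (v f2) →
                     ∀ a b → lookup s a Fin.< lookup s b → v a Fin.< v b)
         (embedding-≺ : ∀ {n} (v : Fin 3 → Fin n) → (∀ a b → lookup s a Fin.< lookup s b → v a Fin.< v b) →
                        Comparison._≺_ C (v f1) (v f2))
         where
  open Comparison C
  open Counting C

  YZero XTwoYZero : Pattern 3
  YZero     = pat s ∅₄ set0
  XTwoYZero = pat s set2 set0

  triple-orderIso : ∀ {n} (π : Vec (Fin (suc n)) (suc n)) → IsPerm π → ∀ {i j l} →
    i Fin.< j → j Fin.< l → lookup π i ≡ Fin.zero → lookup π j ≺ lookup π l →
    OrderIso s (λ a → lookup π (triple i j l a))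
  triple-orderIso π π-perm i<j j<l πi≡0 r =
    embedding⇒orderIso s _ (IsInverse⇒injective s s s-involution)
      (≺-embeds _ (one-below π π-perm πi≡0 (FinP.<⇒≢ i<j)) (one-below π π-perm πi≡0 (FinP.<⇒≢ (FinP.<-trans i<j j<l))) r)

  module _ {n} (π : Vec (Fin (suc n)) (suc n)) where

    contains-YZero⇒pairAfterZero : Contains YZero π → PairAfterZero π
    contains-YZero⇒pairAfterZero (ι , ι-mono , ι-iso , _ , Y-adj) =
      ι f0 , ι f1 , ι f2 , ι-mono f0 f1 (s≤s z≤n) , ι-mono f1 f2 (s≤s (s≤s z≤n)) ,
      Y₀-forces YZero π ι s-first s-least Y-adj , embedding-≺ (λ a → lookup π (ι a)) (λ a b → proj₁ (ι-iso a b))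

    pairAfterZero⇒contains-YZero : IsPerm π → PairAfterZero π → Contains YZero π
    pairAfterZero⇒contains-YZero π-perm (i , j , l , i<j , j<l , πi≡0 , r) =
      triple i j l , triple-monotone i<j j<l , triple-orderIso π π-perm i<j j<l πi≡0 r ,
      X∅-holds YZero π (triple i j l) , Y₀-holds YZero π (triple i j l) s-first s-least πi≡0

    contains-XTwoYZero⇒contains-YZero : Contains XTwoYZero π → Contains YZero π
    contains-XTwoYZero⇒contains-YZero (ι , ι-mono , ι-iso , _ , Y-adj) =
      ι , ι-mono , ι-iso , X∅-holds YZero π ι ,
      Y₀-holds YZero π ι s-first s-least (Y₀-forces XTwoYZero π ι s-first s-least Y-adj)

    -- shrink the ≺-pair of an occurrence of (s,∅,{0}) to an adjacent one
    contains-YZero⇒contains-XTwoYZero : IsPerm π → Contains YZero π → Contains XTwoYZero π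
    contains-YZero⇒contains-XTwoYZero π-perm c with contains-YZero⇒pairAfterZero c
    ... | i , j , l , i<j , j<l , πi≡0 , r with adjacentPair π j l j<l r
    ... | j′ , l′ , adjacent , j≤j′ , r′ =
          triple i j′ l′ , triple-monotone i<j′ j′<l′ , triple-orderIso π π-perm i<j′ j′<l′ πi≡0 r′ ,
          X₂-holds XTwoYZero π (triple i j′ l′) adjacent , Y₀-holds XTwoYZero π (triple i j′ l′) s-first s-least πi≡0
      where
      i<j′ : i Fin.< j′
      i<j′ = ℕP.<-≤-trans i<j j≤j′
      j′<l′ : j′ Fin.< l′
      j′<l′ = ℕP.≤-reflexive (sym adjacent)

  count-YZero : ∀ n → AvoidCount YZero (suc n) (formula (suc n))
  count-YZero n = PermCount-cong
    (λ π _      pair-free c → pair-free (contains-YZero⇒pairAfterZero π c))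
    (λ π π-perm avoids  pr → avoids (pairAfterZero⇒contains-YZero π π-perm pr))
    (pairAfterZero-count n)

  count-XTwoYZero : ∀ n → AvoidCount XTwoYZero (suc n) (formula (suc n))
  count-XTwoYZero n = PermCount-cong
    (λ π _      avoids c → avoids (contains-XTwoYZero⇒contains-YZero π c))
    (λ π π-perm avoids c → avoids (contains-YZero⇒contains-XTwoYZero π π-perm c))
    (count-YZero n)

  -- (s,{0},{2}) is the inverse of (s,{2},{0}) since s is an involution.
  count-XZeroYTwo : ∀ n → AvoidCount (pat s set0 set2) (suc n) (formula (suc n))
  count-XZeroYTwo n = avoidCount-i XTwoYZero s s-involution (count-XTwoYZero n)

punchIn-preserves-< : ∀ {n} (v : Fin (suc n)) (a b : Fin n) → a Fin.< b → punchIn v a Fin.< punchIn v b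
punchIn-preserves-< v a b a<b = ℕP.≰⇒> (λ pb≤pa → ℕP.<⇒≱ a<b (FinP.punchIn-cancel-≤ v b a pb≤pa))

punchIn-reflects-< : ∀ {n} (v : Fin (suc n)) (a b : Fin n) → punchIn v a Fin.< punchIn v b → a Fin.< b
punchIn-reflects-< v a b pa<pb = ℕP.≰⇒> (λ b≤a → ℕP.<⇒≱ pa<pb (FinP.punchIn-mono-≤ v b a b≤a))

below-fromℕ : ∀ {n} (v : Fin (suc n)) → ¬ v ≡ fromℕ n → v Fin.< fromℕ n
below-fromℕ {n} v v≢ = subst (toℕ v ℕ.<_) (sym (FinP.toℕ-fromℕ n))
  (ℕP.≤∧≢⇒< (ℕ.s≤s⁻¹ (FinP.toℕ<n v)) (λ e → v≢ (FinP.toℕ-injective (trans e (sym (FinP.toℕ-fromℕ n))))))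

fromℕ-maximal : ∀ {n} (x : Fin (suc n)) → ¬ fromℕ n Fin.< x
fromℕ-maximal {n} x h = ℕP.<⇒≱ h (subst (toℕ x ℕ.≤_) (sym (FinP.toℕ-fromℕ n)) (ℕ.s≤s⁻¹ (FinP.toℕ<n x)))

ascending : Comparison
ascending = record
  { _≺_                 = Fin._<_
  ; _≺?_                = FinP._<?_
  ; ≺-step              = λ a b c a≮b a<c → ℕP.≤-<-trans (ℕP.≮⇒≥ a≮b) a<c
  ; punchIn-reflects-≺  = punchIn-reflects-<
  ; punchIn-preserves-≺ = punchIn-preserves-<
  ; top                 = fromℕ
  ; ≺-top               = below-fromℕ
  ; top-maximal         = fromℕ-maximal
  }

descending : Comparison
descending = record
  { _≺_                 = λ a b → b Fin.< a
  ; _≺?_                = λ a b → b FinP.<? a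
  ; ≺-step              = λ a b c b≮a c<a → ℕP.<-≤-trans c<a (ℕP.≮⇒≥ b≮a)
  ; punchIn-reflects-≺  = λ v a b → punchIn-reflects-< v b a
  ; punchIn-preserves-≺ = λ v a b → punchIn-preserves-< v b a
  ; top                 = λ _ → Fin.zero
  ; ≺-top               = λ { Fin.zero v≢0 → ⊥-elim (v≢0 refl) ; (Fin.suc v) _ → s≤s z≤n }
  ; top-maximal         = λ x ()
  }

s123-involution : IsInverse s123 s123
s123-involution Fin.zero                     = refl
s123-involution (Fin.suc Fin.zero)           = refl
s123-involution (Fin.suc (Fin.suc Fin.zero)) = refl

s132-involution : IsInverse s132 s132
s132-involution Fin.zero                     = refl
s132-involution (Fin.suc Fin.zero)           = refl
s132-involution (Fin.suc (Fin.suc Fin.zero)) = refl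

s123-least : ∀ a → toℕ (lookup s123 a) ≡ 0 → a ≡ f0
s123-least Fin.zero                     _ = refl
s123-least (Fin.suc Fin.zero)           ()
s123-least (Fin.suc (Fin.suc Fin.zero)) ()

s132-least : ∀ a → toℕ (lookup s132 a) ≡ 0 → a ≡ f0
s132-least Fin.zero                     _ = refl
s132-least (Fin.suc Fin.zero)           ()
s132-least (Fin.suc (Fin.suc Fin.zero)) ()

embeds-123 : ∀ {n} (v : Fin 3 → Fin n) → v f0 Fin.< v f1 → v f0 Fin.< v f2 → v f1 Fin.< v f2 →
  ∀ a b → lookup s123 a Fin.< lookup s123 b → v a Fin.< v b
embeds-123 v v01 v02 v12 Fin.zero                     (Fin.suc Fin.zero)           _ = v01
embeds-123 v v01 v02 v12 Fin.zero                     (Fin.suc (Fin.suc Fin.zero)) _ = v02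
embeds-123 v v01 v02 v12 (Fin.suc Fin.zero)           (Fin.suc (Fin.suc Fin.zero)) _ = v12
embeds-123 v v01 v02 v12 Fin.zero                     Fin.zero                     ()
embeds-123 v v01 v02 v12 (Fin.suc Fin.zero)           Fin.zero                     ()
embeds-123 v v01 v02 v12 (Fin.suc Fin.zero)           (Fin.suc Fin.zero)           (s≤s ())
embeds-123 v v01 v02 v12 (Fin.suc (Fin.suc Fin.zero)) Fin.zero                     ()
embeds-123 v v01 v02 v12 (Fin.suc (Fin.suc Fin.zero)) (Fin.suc Fin.zero)           (s≤s ())
embeds-123 v v01 v02 v12 (Fin.suc (Fin.suc Fin.zero)) (Fin.suc (Fin.suc Fin.zero)) (s≤s (s≤s ()))

embeds-132 : ∀ {n} (v : Fin 3 → Fin n) → v f0 Fin.< v f1 → v f0 Fin.< v f2 → v f2 Fin.< v f1 →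
  ∀ a b → lookup s132 a Fin.< lookup s132 b → v a Fin.< v b
embeds-132 v v01 v02 v21 Fin.zero                     (Fin.suc Fin.zero)           _ = v01
embeds-132 v v01 v02 v21 Fin.zero                     (Fin.suc (Fin.suc Fin.zero)) _ = v02
embeds-132 v v01 v02 v21 (Fin.suc (Fin.suc Fin.zero)) (Fin.suc Fin.zero)           _ = v21
embeds-132 v v01 v02 v21 Fin.zero                     Fin.zero                     ()
embeds-132 v v01 v02 v21 (Fin.suc Fin.zero)           Fin.zero                     ()
embeds-132 v v01 v02 v21 (Fin.suc Fin.zero)           (Fin.suc Fin.zero)           (s≤s (s≤s ()))
embeds-132 v v01 v02 v21 (Fin.suc Fin.zero)           (Fin.suc (Fin.suc Fin.zero)) (s≤s ())
embeds-132 v v01 v02 v21 (Fin.suc (Fin.suc Fin.zero)) Fin.zero                     ()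
embeds-132 v v01 v02 v21 (Fin.suc (Fin.suc Fin.zero)) (Fin.suc (Fin.suc Fin.zero)) (s≤s ())

module Patterns123 = BasePatterns ascending s123 s123-involution refl s123-least
  embeds-123 (λ v embeds → embeds f1 f2 (s≤s (s≤s z≤n)))

module Patterns132 = BasePatterns descending s132 s132-involution refl s132-least
  embeds-132 (λ v embeds → embeds f2 f1 (s≤s (s≤s z≤n)))

count-base : ∀ {b} → BasePattern b → ∀ n → AvoidCount b (suc n) (formula (suc n))
count-base b1 = Patterns123.count-YZero
count-base b2 = Patterns123.count-XZeroYTwo
count-base b3 = Patterns132.count-YZero
count-base b4 = Patterns132.count-XZeroYTwo

mainTheorem9 : ∀ (b p : Pattern 3) → BasePattern b → SymClass b p →
                 ∀ (n : ℕ) → n ≥ 1 → AvoidCount p n (formula n)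
mainTheorem9 b p base p∈class (suc n) _ = avoidCount-symClass p∈class (count-base base n)
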